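{- In the stochastic online bipartite matching problem described in the context, fix any online policy, and let $U^t$ be the node matched at time $t$ (with $U^t=\varnothing$ if the arrival is discarded) and $S^t$ the set of available static nodes at time $t$. Then on every sample path, \[ V^{\mathrm{off}}-V^{\mathrm{on}}=\sum_{t\in[T]}\mathbf{1}\{Q(t,U^t,S^t)\}. \]
   Context: There is a finite set $U$ of static nodes and a finite set $V$ of online node types; each $v\in V$ has a neighbor set $N(v)\subseteq U$. Time is indexed by time-to-go $t=T,\dots,1$, and arrivals $\theta^T,\dots,\theta^1\in V$ are random; each arrival is a distinct online node adjacent to $N(\theta^t)$. Starting from $S^T=U$, at time $t$ an online (non-anticipatory) policy chooses $U^t\in(N(\theta^t)\cap S^t)\cup\{\varnothing\}$ and sets $S^{t-1}=S^t\setminus\{U^t\}$; $V^{\mathrm{on}}$ is the number of times $U^t\ne\varnothing$. $V^{\mathrm{off}}$ is the size of a maximum matching in the bipartite graph between $U$ and all $T$ arrival nodes. For a bipartite graph $G$, $M(G)$ is its maximum matching size; for a static node $u$ and online node $v$, $G-(u,v)$ removes both nodes, and $G-(\varnothing,v)=G-v$. For $s\subseteq U$, let $G_t(s)$ be the bipartite graph between $s$ and the arrival nodes at times $t,t-1,\dots,1$. With $\mathbf{1}_\varnothing=0$ and $\mathbf{1}_u=1$ for $u\in U$, define $Q(t,u,s)$ as the complement of the event $\{M(G_t(s))=\mathbf{1}_u+M(G_t(s)-(u,\theta^t))\}$, where $\theta^t$ denotes the arrival node at time $t$. -}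

module Defs where

open import Data.Nat using (ℕ; zero; suc; _+_; _≤_; _≟_)
open import Data.Fin using (Fin)
open import Data.Fin.Subset using (Subset; _∈_; _-_; ⊤)
open import Data.List using (List; []; _∷_; length; map; lookup)
open import Data.Nat.ListAction using (sum)
open import Data.List.Relation.Unary.All using (All)
open import Data.List.Relation.Unary.Unique.Propositional using (Unique)
open import Data.Maybe using (Maybe; just; nothing)
open import Data.Product using (_×_; _,_; proj₁; proj₂; Σ; ∃)
open import Data.Bool using (if_then_else_)
open import Relation.Nullary using (does)
open import Relation.Binary.PropositionalEquality using (_≡_)

-- Bipartite graphs between a set of static nodes (a subset of Fin m)
-- and a list of online nodes, each online node given by its neighbour
-- set N(v) ⊆ Fin m.

record BGraph (m : ℕ) : Set where
  constructor bgraph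
  field
    static : Subset m
    online : List (Subset m)
open BGraph public

IsEdge : ∀ {m} (G : BGraph m) → Fin m × Fin (length (online G)) → Set
IsEdge G (u , i) = (u ∈ static G) × (u ∈ lookup (online G) i)

record Matching {m} (G : BGraph m) : Set where
  constructor matching
  field
    edges      : List (Fin m × Fin (length (online G)))
    areEdges   : All (IsEdge G) edges
    staticDist : Unique (map proj₁ edges)
    onlineDist : Unique (map proj₂ edges)
open Matching public

size : ∀ {m} {G : BGraph m} → Matching G → ℕ
size M = length (edges M)

IsMaxMatchingSize : ∀ {m} → BGraph m → ℕ → Set
IsMaxMatchingSize G k =
  (Σ (Matching G) λ M → size M ≡ k) × (∀ (M : Matching G) → size M ≤ k)

-- G − (u , v) where v is the first online node; G − (∅ , v) = G − v.
removePair : ∀ {m} → Maybe (Fin m) → BGraph m → BGraph m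
removePair c (bgraph s []) = bgraph s []
removePair nothing  (bgraph s (_ ∷ ws)) = bgraph s ws
removePair (just u) (bgraph s (_ ∷ ws)) = bgraph (s - u) ws

ind : ∀ {m} → Maybe (Fin m) → ℕ
ind nothing  = 0
ind (just _) = 1

-- At time-to-go t, having observed the current arrival
-- θ^t and the past arrivals θ^T,…,θ^{t+1} (most recent first), and the
-- current available set S^t, the policy chooses U^t ∈ (N(θ^t) ∩ S^t) ∪ {∅}.

Policy : ℕ → ℕ → Set
Policy m n = (t : ℕ) → (θ : Fin n) → (past : List (Fin n)) → Subset m → Maybe (Fin m)

Feasible : ∀ {m n} → (Fin n → Subset m) → Policy m n → Set
Feasible N π = ∀ t θ past S u → π t θ past S ≡ just u → (u ∈ N θ) × (u ∈ S)

remove : ∀ {m} → Maybe (Fin m) → Subset m → Subset m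
remove nothing  S = S
remove (just u) S = S - u

-- One step of the trace: (U^t , S^t , remaining arrivals θ^t,…,θ^1).
Step : ℕ → ℕ → Set
Step m n = Maybe (Fin m) × Subset m × List (Fin n)

-- Run the policy on the future arrivals (head = current time), starting
-- from available set S, returning the trace for times t = T,…,1.
run : ∀ {m n} → Policy m n → List (Fin n) → List (Fin n) → Subset m → List (Step m n)
run π past [] S = []
run π past (θ ∷ rest) S =
  let c = π (suc (length rest)) θ past S in
  (c , S , θ ∷ rest) ∷ run π (θ ∷ past) rest (remove c S)

Gt : ∀ {m n} → (Fin n → Subset m) → Subset m → List (Fin n) → BGraph m
Gt N s arr = bgraph s (map N arr)

Von : ∀ {m n} → List (Step m n) → ℕ
Von tr = sum (map (λ st → ind (proj₁ st)) tr)

Voff : ∀ {m n} → (BGraph m → ℕ) → (Fin n → Subset m) → List (Fin n) → ℕ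
Voff M N arr = M (Gt N ⊤ arr)

indQ : ∀ {m n} → (BGraph m → ℕ) → (Fin n → Subset m) → Step m n → ℕ
indQ M N (u , s , arr) =
  if does (M (Gt N s arr) ≟ ind u + M (removePair u (Gt N s arr))) then 0 else 1

sumQ : ∀ {m n} → (BGraph m → ℕ) → (Fin n → Subset m) → List (Step m n) → ℕ
sumQ M N tr = sum (map (indQ M N) tr)

module Submission where

-- The gap between the offline optimum and an online policy telescopes.
--
-- Let G = G_t(S^t) be the graph still in play at time t, with first online
-- node θ^t, and let c = U^t be the policy's (feasible) choice.  The key fact is
-- the one-step sandwich
--     1_c + M(G − (c, θ^t))  ≤  M(G)  ≤  1 + 1_c + M(G − (c, θ^t)),
-- so M(G) − 1_c − M(G − (c, θ^t)) is exactly the indicator of Q(t, c, S^t).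
-- Since G − (c, θ^t) = G_{t-1}(S^{t-1}), summing over t telescopes from
-- M(G_T(U)) = V^off down to M(G_0(·)) = 0, giving V^off = V^on + Σ_t 1{Q}.

open import Defs
open import Data.Nat using (ℕ; _+_)
open import Data.Fin using (Fin)
open import Data.Fin.Subset using (Subset; ⊤)
open import Data.List using (List; [])
open import Relation.Binary.PropositionalEquality using (_≡_)

open import Data.Nat using (zero; suc; _≤_; z≤n; s≤s; _≟_; _≡ᵇ_)
open import Data.Nat.Properties using (≤-trans; ≤-antisym; ≤-reflexive; ≤∧≢⇒<; +-comm; +-identityʳ; +-monoʳ-≤; ≡ᵇ⇒≡; ≡⇒≡ᵇ)
open import Data.Nat.Solver using (module +-*-Solver)
open import Data.Fin using (zero; suc) renaming (_≟_ to _≟ᶠ_)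
open import Data.Fin.Properties using (suc-injective)
open import Data.Fin.Subset using (_∈_; _∉_; _-_; _⊆_; ⁅_⁆)
open import Data.Fin.Subset.Properties using (x∈p∧x≢y⇒x∈p-y; p─q⊆p)
open import Data.Vec using (_∷_; there)
open import Data.List using (_∷_; length; mapMaybe)
open import Data.List.Relation.Unary.All using (All; []; _∷_)
import Data.List.Relation.Unary.All as All
import Data.List.Relation.Unary.All.Properties as All
open import Data.List.Relation.Unary.AllPairs using (AllPairs; []; _∷_)
import Data.List.Relation.Unary.AllPairs as AllPairs
import Data.List.Relation.Unary.AllPairs.Properties as AllPairs
open import Data.Maybe using (Maybe; just; nothing)
import Data.Maybe.Relation.Unary.All as Maybe
open import Data.Product using (_×_; _,_; proj₁; proj₂; Σ)
open import Data.Sum using (_⊎_; inj₁; inj₂)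
open import Data.Empty using (⊥; ⊥-elim)
open import Data.Bool using (if_then_else_; true; false; T)
open import Data.Unit using (tt)
open import Relation.Nullary using (yes; no; does)
open import Relation.Binary.PropositionalEquality using (refl; sym; trans; cong; subst; _≢_; module ≡-Reasoning)

∈-minus⇒≢ : ∀ {k} {x y : Fin k} {p : Subset k} → x ∈ p - y → x ≢ y
∈-minus⇒≢ {p = p} x∈p-y refl = x∉p-x p x∈p-y
  where
  x∉p-x : ∀ {k} {x : Fin k} (p : Subset k) → x ∉ p - x
  x∉p-x {x = zero}  (_ ∷ p) ()
  x∉p-x {x = suc x} (_ ∷ p) (there x∈p-x) = x∉p-x p x∈p-x

module _ {A B : Set} (f : A → Maybe B) where

  along : ∀ {P : A → Set} {Q : B → Set}
        → (∀ {a b} → f a ≡ just b → P a → Q b) → ∀ {a} → P a → Maybe.All Q (f a)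
  along h {a} pa with f a in eq
  ... | just b  = Maybe.just (h eq pa)
  ... | nothing = Maybe.nothing

  mapMaybe-All : ∀ {P : A → Set} {Q : B → Set}
               → (∀ {a b} → f a ≡ just b → P a → Q b)
               → ∀ {xs} → All P xs → All Q (mapMaybe f xs)
  mapMaybe-All h ps = All.mapMaybe⁺ (All.map⁺ (All.map (along h) ps))

  mapMaybe-AllPairs : ∀ {R : A → A → Set} {R′ : B → B → Set}
                    → (∀ {a a′ b b′} → f a ≡ just b → f a′ ≡ just b′ → R a a′ → R′ b b′)
                    → ∀ {xs} → AllPairs R xs → AllPairs R′ (mapMaybe f xs)
  mapMaybe-AllPairs h [] = []
  mapMaybe-AllPairs h {x ∷ xs} (rs ∷ rss) with f x in eq
  ... | nothing = mapMaybe-AllPairs h rss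
  ... | just b  = mapMaybe-All (h eq) rs ∷ mapMaybe-AllPairs h rss

  length-mapMaybe-total : ∀ {xs} → All (λ a → f a ≢ nothing) xs
                        → length (mapMaybe f xs) ≡ length xs
  length-mapMaybe-total [] = refl
  length-mapMaybe-total {x ∷ xs} (d ∷ ds) with f x
  ... | nothing = ⊥-elim (d refl)
  ... | just _  = cong suc (length-mapMaybe-total ds)

  length-mapMaybe-≤ : ∀ {xs} → AllPairs (λ a a′ → f a ≡ nothing → f a′ ≡ nothing → ⊥) xs
                    → length xs ≤ suc (length (mapMaybe f xs))
  length-mapMaybe-≤ [] = z≤n
  length-mapMaybe-≤ {x ∷ xs} (rs ∷ rss) with f x
  ... | just _  = s≤s (length-mapMaybe-≤ rss)
  ... | nothing = s≤s (≤-reflexive (sym (length-mapMaybe-total (All.map (λ r → r refl) rs))))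

module _ {m : ℕ} where

  Edge : BGraph m → Set
  Edge G = Fin m × Fin (length (online G))

  -- A partial map of edge slots that sends edges to edges and is injective
  -- on static and on online endpoints; it carries matchings of G to H.
  record Relabelling (G H : BGraph m) : Set where
    field
      image            : Edge G → Maybe (Edge H)
      preserves-edges  : ∀ {a b} → image a ≡ just b → IsEdge G a → IsEdge H b
      static-injective : ∀ {a a′ b b′} → image a ≡ just b → image a′ ≡ just b′
                       → proj₁ b ≡ proj₁ b′ → proj₁ a ≡ proj₁ a′
      online-injective : ∀ {a a′ b b′} → image a ≡ just b → image a′ ≡ just b′
                       → proj₂ b ≡ proj₂ b′ → proj₂ a ≡ proj₂ a′

  module _ {G H : BGraph m} (R : Relabelling G H) where
    open Relabelling R

    relabel : Matching G → Matching H
    relabel (matching es areE sd od) = matching (mapMaybe image es)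
      (mapMaybe-All image preserves-edges areE)
      (AllPairs.map⁺ (mapMaybe-AllPairs image
        (λ e e′ ≢₁ ≡₁ → ≢₁ (static-injective e e′ ≡₁)) (AllPairs.map⁻ sd)))
      (AllPairs.map⁺ (mapMaybe-AllPairs image
        (λ e e′ ≢₂ ≡₂ → ≢₂ (online-injective e e′ ≡₂)) (AllPairs.map⁻ od)))

    relabel-size-total : (∀ a → image a ≢ nothing) → ∀ P → size (relabel P) ≡ size P
    relabel-size-total total (matching es _ _ _) =
      length-mapMaybe-total image {es} (All.tabulate (λ {a} _ → total a))

    -- If all discarded slots share an endpoint, a matching (whose edges have
    -- pairwise distinct endpoints) contains at most one of them.
    relabel-size-≤ : (∀ {a a′} → image a ≡ nothing → image a′ ≡ nothing
                       → proj₁ a ≡ proj₁ a′ ⊎ proj₂ a ≡ proj₂ a′)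
                   → ∀ P → size P ≤ suc (size (relabel P))
    relabel-size-≤ share (matching es _ sd od) = length-mapMaybe-≤ image
      (AllPairs.map disjoint (AllPairs.zip (AllPairs.map⁻ sd , AllPairs.map⁻ od)))
      where
      disjoint : ∀ {a a′} → proj₁ a ≢ proj₁ a′ × proj₂ a ≢ proj₂ a′
               → image a ≡ nothing → image a′ ≡ nothing → ⊥
      disjoint (≢₁ , ≢₂) e e′ with share e e′
      ... | inj₁ ≡₁ = ≢₁ ≡₁
      ... | inj₂ ≡₂ = ≢₂ ≡₂

  shiftImage : ∀ {k} → Fin m × Fin k → Maybe (Fin m × Fin (suc k))
  shiftImage (u , i) = just (u , suc i)

  shiftOnline : ∀ {s′ s w ws} → s′ ⊆ s → Relabelling (bgraph s′ ws) (bgraph s (w ∷ ws))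
  shiftOnline s′⊆s = record
    { image            = shiftImage
    ; preserves-edges  = λ { refl (u∈s′ , u∈w) → s′⊆s u∈s′ , u∈w }
    ; static-injective = λ { refl refl ≡₁ → ≡₁ }
    ; online-injective = λ { refl refl ≡₂ → suc-injective ≡₂ }
    }

  forgetFirstImage : ∀ {k} → Fin m × Fin (suc k) → Maybe (Fin m × Fin k)
  forgetFirstImage (u , zero)  = nothing
  forgetFirstImage (u , suc i) = just (u , i)

  forgetFirstOnline : ∀ {s w ws} → Relabelling (bgraph s (w ∷ ws)) (bgraph s ws)
  forgetFirstOnline = record
    { image            = forgetFirstImage
    ; preserves-edges  = λ { {_ , suc _} refl e → e }
    ; static-injective = λ { {_ , suc _} {_ , suc _} refl refl ≡₁ → ≡₁ }
    ; online-injective = λ { {_ , suc _} {_ , suc _} refl refl ≡₂ → cong suc ≡₂ }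
    }

  forgetFirst-discards : ∀ {k} {a a′ : Fin m × Fin (suc k)}
    → forgetFirstImage a ≡ nothing → forgetFirstImage a′ ≡ nothing
    → proj₁ a ≡ proj₁ a′ ⊎ proj₂ a ≡ proj₂ a′
  forgetFirst-discards {a = _ , zero} {_ , zero} refl refl = inj₂ refl

  forgetStaticImage : ∀ {k} → Fin m → Fin m × Fin k → Maybe (Fin m × Fin k)
  forgetStaticImage u (v , i) with v ≟ᶠ u
  ... | yes _ = nothing
  ... | no _  = just (v , i)

  forgetStatic-defined : ∀ {k} {u} {a b : Fin m × Fin k}
    → forgetStaticImage u a ≡ just b → a ≡ b × proj₁ a ≢ u
  forgetStatic-defined {u = u} {v , i} e with v ≟ᶠ u
  forgetStatic-defined refl | no v≢u = refl , v≢u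

  forgetStatic-discarded : ∀ {k} {u} {a : Fin m × Fin k}
    → forgetStaticImage u a ≡ nothing → proj₁ a ≡ u
  forgetStatic-discarded {u = u} {v , i} e with v ≟ᶠ u
  forgetStatic-discarded refl | yes v≡u = v≡u

  forgetStatic : ∀ {s ws} (u : Fin m) → Relabelling (bgraph s ws) (bgraph (s - u) ws)
  forgetStatic {s} {ws} u = record
    { image            = forgetStaticImage u
    ; preserves-edges  = preserves
    ; static-injective = injective proj₁
    ; online-injective = injective proj₂
    }
    where
    preserves : ∀ {a b} → forgetStaticImage u a ≡ just b
              → IsEdge (bgraph s ws) a → IsEdge (bgraph (s - u) ws) b
    preserves e (v∈s , v∈w) with forgetStatic-defined e
    ... | refl , v≢u = x∈p∧x≢y⇒x∈p-y v∈s v≢u , v∈w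
    injective : ∀ {C : Set} (endpoint : Edge (bgraph s ws) → C) {a a′ b b′}
              → forgetStaticImage u a ≡ just b → forgetStaticImage u a′ ≡ just b′
              → endpoint b ≡ endpoint b′ → endpoint a ≡ endpoint a′
    injective endpoint e e′ eq with forgetStatic-defined e | forgetStatic-defined e′
    ... | refl , _ | refl , _ = eq

  extend : ∀ {G} (P : Matching G) (e : Edge G) → IsEdge G e
         → All (λ b → proj₁ b ≢ proj₁ e × proj₂ b ≢ proj₂ e) (edges P) → Matching G
  extend (matching es areE sd od) e isE fresh = matching (e ∷ es) (isE ∷ areE)
    (All.map⁺ (All.map (λ f e≡b → proj₁ f (sym e≡b)) fresh) ∷ sd)
    (All.map⁺ (All.map (λ f e≡b → proj₂ f (sym e≡b)) fresh) ∷ od)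

module _ {m : ℕ} where

  Transfer : BGraph m → BGraph m → ℕ → ℕ → Set
  Transfer G H a b = (P : Matching G) → Σ (Matching H) λ Q → a + size P ≤ b + size Q

  transfer-max : ∀ {G H a b k l} → Transfer G H a b
               → IsMaxMatchingSize G k → IsMaxMatchingSize H l → a + k ≤ b + l
  transfer-max {b = b} T ((P , refl) , _) (_ , maximal) =
    ≤-trans (proj₂ (T P)) (+-monoʳ-≤ b (maximal (proj₁ (T P))))

  no-online-size : ∀ {s : Subset m} (P : Matching (bgraph s [])) → size P ≡ 0
  no-online-size (matching []                _ _ _) = refl
  no-online-size (matching ((_ , ()) ∷ _) _ _ _)

  skip-lower : ∀ {s w ws} → Transfer (bgraph s ws) (bgraph s (w ∷ ws)) 0 0
  skip-lower P = relabel R P , ≤-reflexive (sym (relabel-size-total R (λ _ ()) P))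
    where R = shiftOnline (λ x∈s → x∈s)

  -- M(G) ≤ 1 + M(G − v): a single online node carries at most one edge.
  skip-upper : ∀ {s w ws} → Transfer (bgraph s (w ∷ ws)) (bgraph s ws) 0 1
  skip-upper P = relabel forgetFirstOnline P
               , relabel-size-≤ forgetFirstOnline forgetFirst-discards P

  forget-static-upper : ∀ {s ws} (u : Fin m) → Transfer (bgraph s ws) (bgraph (s - u) ws) 0 1
  forget-static-upper u P = relabel (forgetStatic u) P
    , relabel-size-≤ (forgetStatic u)
        (λ e e′ → inj₁ (trans (forgetStatic-discarded e) (sym (forgetStatic-discarded e′)))) P

  -- M(G) ≥ 1 + M(G − (u, v)) for an edge (u, v): match u to v, then the rest.
  match-lower : ∀ {s w ws} (u : Fin m) → u ∈ s → u ∈ w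
              → Transfer (bgraph (s - u) ws) (bgraph s (w ∷ ws)) 1 0
  match-lower {s} {w} {ws} u u∈s u∈w P@(matching es areE _ _) =
    extend (relabel R P) (u , zero) (u∈s , u∈w) (mapMaybe-All shiftImage fresh areE)
    , s≤s (≤-reflexive (sym (relabel-size-total R (λ _ ()) P)))
    where
    R = shiftOnline {w = w} (p─q⊆p s ⁅ u ⁆)
    fresh : ∀ {a b} → shiftImage a ≡ just b → IsEdge (bgraph (s - u) ws) a
          → proj₁ b ≢ u × proj₂ b ≢ zero
    fresh refl (v∈s-u , _) = ∈-minus⇒≢ v∈s-u , λ ()

module MaximumMatching {m : ℕ} (M : BGraph m → ℕ) (isMax : ∀ G → IsMaxMatchingSize G (M G)) where

  compare : ∀ {G H a b} → Transfer G H a b → a + M G ≤ b + M H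
  compare T = transfer-max T (isMax _) (isMax _)

  no-online-max : ∀ s → M (bgraph s []) ≡ 0
  no-online-max s = trans (sym (proj₂ witness)) (no-online-size (proj₁ witness))
    where witness = proj₁ (isMax (bgraph s []))

  sandwich : ∀ {s w ws} (c : Maybe (Fin m)) → (∀ u → c ≡ just u → u ∈ w × u ∈ s)
    → (ind c + M (removePair c (bgraph s (w ∷ ws))) ≤ M (bgraph s (w ∷ ws)))
    × (M (bgraph s (w ∷ ws)) ≤ suc (ind c + M (removePair c (bgraph s (w ∷ ws)))))
  sandwich nothing  _   = compare skip-lower , compare skip-upper
  sandwich (just u) adm =
    compare (match-lower u (proj₂ (adm u refl)) (proj₁ (adm u refl)))
    , ≤-trans (compare skip-upper) (s≤s (compare (forget-static-upper u)))

-- If b ≤ a ≤ 1 + b then a − b is the indicator of a ≠ b.  (The test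
-- does (a ≟ b) computes to the boolean a ≡ᵇ b, on which we case split.)
gap-indicator : ∀ a b → b ≤ a → a ≤ suc b → a ≡ b + (if does (a ≟ b) then 0 else 1)
gap-indicator a b b≤a a≤1+b with a ≡ᵇ b in a≡ᵇb
... | true  = trans (≡ᵇ⇒≡ a b (subst T (sym a≡ᵇb) tt)) (sym (+-identityʳ b))
... | false = trans (≤-antisym a≤1+b (≤∧≢⇒< b≤a b≢a)) (+-comm 1 b)
  where
  b≢a : b ≢ a
  b≢a refl = subst T a≡ᵇb (≡⇒≡ᵇ a a refl)

remove-first-arrival : ∀ {m n} (N : Fin n → Subset m) S θ rest (c : Maybe (Fin m))
  → removePair c (Gt N S (θ ∷ rest)) ≡ Gt N (remove c S) rest
remove-first-arrival N S θ rest nothing  = refl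
remove-first-arrival N S θ rest (just u) = refl

rearrange : ∀ a b d e → (a + (b + d)) + e ≡ (a + b) + (e + d)
rearrange = solve 4 (λ a b d e → (a :+ (b :+ d)) :+ e := (a :+ b) :+ (e :+ d)) refl
  where open +-*-Solver

telescope : ∀ {m n} (N : Fin n → Subset m)
  → (M : BGraph m → ℕ) → (∀ G → IsMaxMatchingSize G (M G))
  → (π : Policy m n) → Feasible N π
  → ∀ past S arr → M (Gt N S arr) ≡ Von (run π past arr S) + sumQ M N (run π past arr S)
telescope N M isMax π feasible past S [] = no-online-max S
  where open MaximumMatching M isMax
telescope N M isMax π feasible past S (θ ∷ rest) = begin
  M G                                   ≡⟨ gap-indicator (M G) _ (proj₁ bounds) (proj₂ bounds) ⟩
  (ind c + M (removePair c G)) + q      ≡⟨ cong (λ x → (ind c + M x) + q) (remove-first-arrival N S θ rest c) ⟩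
  (ind c + M (Gt N S′ rest)) + q        ≡⟨ cong (λ x → (ind c + x) + q) (telescope N M isMax π feasible (θ ∷ past) S′ rest) ⟩
  (ind c + (Von tr + sumQ M N tr)) + q  ≡⟨ rearrange (ind c) (Von tr) (sumQ M N tr) q ⟩
  (ind c + Von tr) + (q + sumQ M N tr)  ∎
  where
  open ≡-Reasoning
  open MaximumMatching M isMax
  c  = π (suc (length rest)) θ past S
  G  = Gt N S (θ ∷ rest)
  S′ = remove c S
  tr = run π (θ ∷ past) rest S′
  q  = if does (M G ≟ ind c + M (removePair c G)) then 0 else 1
  bounds = sandwich c (λ u c≡u → feasible _ θ past S u c≡u)

lemma3 : (m n : ℕ) (N : Fin n → Subset m)
    → (M : BGraph m → ℕ) → (∀ G → IsMaxMatchingSize G (M G))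
    → (π : Policy m n) → Feasible N π
    → (arrivals : List (Fin n))
    → Voff M N arrivals ≡ Von (run π [] arrivals ⊤) + sumQ M N (run π [] arrivals ⊤)
lemma3 m n N M isMax π feasible arrivals = telescope N M isMax π feasible [] ⊤ arrivals
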